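{- For all $n,m\in\mathbb{N}_{>0}$: $\text{ffn}(K_n)=n$ and $\text{ffn}(K_{n,m})=\min\{n,m\}+1$; and for all $n\in\mathbb{N}_{\ge3}$: $\text{ffn}(C_n)=3$. Here $K_n$ is the complete graph on $n$ nodes, $K_{n,m}$ the complete bipartite graph with parts of sizes $n$ and $m$, and $C_n$ the cycle on $n$ nodes.
   Context: All graphs are finite, simple and undirected. For a graph $G=(V,E)$ and $W\subseteq V$, $N(W)$ is the set of nodes in $V\setminus W$ adjacent to at least one node of $W$. For $m\in\mathbb{N}_{>0}$, an $m$-strategy of length $T$ is a sequence $(F_1,\dots,F_T)$ of subsets of $V$ with $|F_i|\le m$. Its burning sets are $B_0=V$ and $B_t=(B_{t-1}\setminus F_t)\cup N(B_{t-1}\setminus F_t)$ for $t\ge1$, where $F_t=\emptyset$ for $t>T$. The strategy is winning if $B_T=\emptyset$. The firefighter number $\text{ffn}(G)$ is the smallest $m$ for which a winning $m$-strategy for $G$ exists. -}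

module Defs where

open import Data.Nat using (ℕ; zero; suc; _≤_; _<_; _+_; _⊓_)
open import Data.Nat.Properties using (_≟_; _<?_)
open import Data.Fin.Properties using () renaming (_≟_ to _F≟_)
open import Data.Bool.Properties using (∨-comm; ∧-zeroʳ)
open import Data.Empty using (⊥-elim)
open import Relation.Nullary using (yes; no)
open import Data.Bool using (Bool; true; false; not; _∧_; _∨_)
open import Data.Fin using (Fin; toℕ)
open import Data.Fin.Subset using (Subset; ∣_∣; ⊥; ⊤; _∪_; _─_; _∈_; _∉_)
open import Data.Vec using (Vec; tabulate; lookup)
open import Data.List using (List; []; _∷_; length)
open import Data.List.Relation.Unary.All using (All)
open import Data.Product using (Σ; _×_; ∃)
open import Relation.Binary.PropositionalEquality using (_≡_; refl; cong; cong₂; trans)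
import Relation.Binary.PropositionalEquality as Eq
open import Relation.Nullary.Decidable using (⌊_⌋)

record Graph (n : ℕ) : Set where
  field
    adj   : Fin n → Fin n → Bool
    sym   : ∀ u v → adj u v ≡ adj v u
    irrefl : ∀ v → adj v v ≡ false
open Graph public

anyFin : ∀ {n} → (Fin n → Bool) → Bool
anyFin {zero} f = false
anyFin {suc n} f = f Fin.zero ∨ anyFin {n} (λ i → f (Fin.suc i))

N : ∀ {n} → Graph n → Subset n → Subset n
N {n} G W = tabulate λ v → not (lookup W v) ∧ anyFin (λ u → lookup W u ∧ adj G u v)

step : ∀ {n} → Graph n → Subset n → Subset n → Subset n
step G B F = (B ─ F) ∪ N G (B ─ F)

burnFrom : ∀ {n} → Graph n → Subset n → List (Subset n) → Subset n
burnFrom G B [] = B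
burnFrom G B (F ∷ Fs) = burnFrom G (step G B F) Fs

burning : ∀ {n} → Graph n → List (Subset n) → Subset n
burning G Fs = burnFrom G ⊤ Fs

IsStrategy : ∀ {n} → ℕ → List (Subset n) → Set
IsStrategy m Fs = All (λ F → ∣ F ∣ ≤ m) Fs

Winning : ∀ {n} → Graph n → List (Subset n) → Set
Winning G Fs = burning G Fs ≡ ⊥

HasWinning : ∀ {n} → Graph n → ℕ → Set
HasWinning G m = Σ (List _) λ Fs → IsStrategy m Fs × Winning G Fs

FfnIs : ∀ {n} → Graph n → ℕ → Set
FfnIs G k = 1 ≤ k × HasWinning G k × (∀ m → 1 ≤ m → HasWinning G m → k ≤ m)

neqF : ∀ {n} → Fin n → Fin n → Bool
neqF u v = not ⌊ u F≟ v ⌋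

mkGraph : ∀ {n} → (Fin n → Fin n → Bool) → Graph n
mkGraph r = record
  { adj = λ u v → (r u v ∨ r v u) ∧ neqF u v
  ; sym = λ u v → cong₂ _∧_ (∨-comm (r u _) (r v _)) (neq-sym u v)
  ; irrefl = λ v → trans (cong ((r v v ∨ r v v) ∧_) (neq-refl v)) (∧-zeroʳ _) }
  where
  neq-refl : ∀ {n} (v : Fin n) → neqF v v ≡ false
  neq-refl v with v F≟ v
  ... | yes _ = refl
  ... | no ¬p = ⊥-elim (¬p refl)
  neq-sym : ∀ {n} (u v : Fin n) → neqF u v ≡ neqF v u
  neq-sym u v with u F≟ v | v F≟ u
  ... | yes _ | yes _ = refl
  ... | no _ | no _ = refl
  ... | yes p | no ¬q = ⊥-elim (¬q (Eq.sym p))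
  ... | no ¬p | yes q = ⊥-elim (¬p (Eq.sym q))

complete : (n : ℕ) → Graph n
complete n = mkGraph (λ _ _ → true)

-- Complete bipartite graph K_{n,m} on Fin (n + m): parts {i | i < n} and {i | i ≥ n};
-- u ~ v iff they lie in different parts
completeBipartite : (n m : ℕ) → Graph (n + m)
completeBipartite n m = mkGraph (λ u v → ⌊ toℕ u <? n ⌋ ∧ not ⌊ toℕ v <? n ⌋)

-- Cycle C_n on Fin n: u ~ v iff v ≡ u + 1 (mod n)  (intended for n ≥ 3)
cycle : (n : ℕ) → Graph n
cycle n = mkGraph (λ u v → ⌊ suc (toℕ u) ≟ toℕ v ⌋ ∨ (⌊ suc (toℕ u) ≟ n ⌋ ∧ ⌊ toℕ v ≟ 0 ⌋))

-- If every closed neighbourhood N[x] of G has more than m nodes, m firefighters can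
-- never bring the fire below m + 1 nodes: whenever more than m nodes burn, one of them,
-- x, is left unprotected, and all of N[x] burns in the next round. So ffn(G) is at
-- least the minimum of |N[x]|.
-- Conversely, let S be a set of nodes such that every edge of G − S joins nodes whose
-- indices differ by at most w. Protecting S together with a window of w + 1 consecutive
-- indices that advances by one each round confines the fire to S and the nodes beyond
-- the window, so |S| + w + 1 firefighters win. Take for K_n all nodes but one and for
-- K_{n,m} the smaller side (w = 0: these are vertex covers), and for C_n a single node,
-- whose removal leaves a path (w = 1). The bounds meet at n, min{n,m} + 1 and 3.

module Submission where

open import Defs hiding (sym)
open import Data.Nat using (ℕ; zero; suc; _+_; _∸_; _⊓_; _≤_; _<_; z≤n; s≤s; _≤ᵇ_; _<ᵇ_; _≡ᵇ_)
open import Data.Nat.Properties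
open import Data.Product using (_×_; _,_; proj₁; proj₂; ∃)
open import Data.Sum using (_⊎_; inj₁; inj₂; [_,_])
open import Data.Bool using (Bool; true; false; T; not; _∧_; _∨_)
open import Data.Bool.Properties using (T-≡; T-∧; T-∨)
open import Data.Fin using (Fin; zero; suc; toℕ; fromℕ; fromℕ<; inject₁)
open import Data.Fin.Properties using (toℕ-injective; toℕ<n; toℕ-fromℕ; toℕ-fromℕ<; toℕ-inject₁) renaming (_≟_ to _≟ᶠ_)
open import Data.Fin.Subset
open import Data.Fin.Subset.Properties
open import Data.Vec using ([]; _∷_; lookup; tabulate; here; there)
open import Data.Vec.Properties using (lookup∘tabulate; []=⇒lookup; lookup⇒[]=)
open import Data.List using (List; []; _∷_; applyUpTo)
import Data.List.Relation.Unary.All as All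
open import Data.List.Relation.Unary.All.Properties using (applyUpTo⁺₂)
open import Function using (_∘_; _⇔_; mk⇔; Equivalence; case_of_)
open import Relation.Binary.PropositionalEquality using (_≡_; _≢_; refl; sym; trans; cong; subst; subst₂)
open import Relation.Nullary using (¬_; yes; no; contradiction)
open import Relation.Nullary.Decidable using (⌊_⌋; toWitness; fromWitness)

open Equivalence using (to; from)

private variable
  n m : ℕ

T-not⇔¬T : {b : Bool} → T (not b) ⇔ (¬ T b)
T-not⇔¬T {false} = mk⇔ (λ _ ()) _
T-not⇔¬T {true}  = mk⇔ (λ ()) (λ ¬t → ¬t _)

∈⇔T-lookup : {p : Subset n} {x : Fin n} → x ∈ p ⇔ T (lookup p x)
∈⇔T-lookup {p = p} {x} = mk⇔ (from T-≡ ∘ []=⇒lookup) (lookup⇒[]= x p ∘ to T-≡)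

∈-tabulate : {f : Fin n → Bool} {x : Fin n} → x ∈ tabulate f ⇔ T (f x)
∈-tabulate {f = f} {x} = subst (λ b → x ∈ tabulate f ⇔ T b) (lookup∘tabulate f x) ∈⇔T-lookup

x∈p─q⇒x∉q : {p q : Subset n} {x : Fin n} → x ∈ p ─ q → x ∉ q
x∈p─q⇒x∉q {p = _ ∷ _} {outside ∷ _} here ()
x∈p─q⇒x∉q {p = _ ∷ p} {_ ∷ q} (there x∈p─q) (there x∈q) = x∈p─q⇒x∉q {p = p} {q} x∈p─q x∈q

∣p∪q∣≤∣p∣+∣q∣ : (p q : Subset n) → ∣ p ∪ q ∣ ≤ ∣ p ∣ + ∣ q ∣
∣p∪q∣≤∣p∣+∣q∣ []            []            = z≤n
∣p∪q∣≤∣p∣+∣q∣ (outside ∷ p) (outside ∷ q) = ∣p∪q∣≤∣p∣+∣q∣ p q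
∣p∪q∣≤∣p∣+∣q∣ (outside ∷ p) (inside  ∷ q) =
  ≤-trans (s≤s (∣p∪q∣≤∣p∣+∣q∣ p q)) (≤-reflexive (sym (+-suc ∣ p ∣ ∣ q ∣)))
∣p∪q∣≤∣p∣+∣q∣ (inside  ∷ p) (outside ∷ q) = s≤s (∣p∪q∣≤∣p∣+∣q∣ p q)
∣p∪q∣≤∣p∣+∣q∣ (inside  ∷ p) (inside  ∷ q) =
  s≤s (≤-trans (∣p∪q∣≤∣p∣+∣q∣ p q) (+-monoʳ-≤ ∣ p ∣ (n≤1+n ∣ q ∣)))

∣q∣<∣p∣⇒Nonempty[p─q] : (p q : Subset n) → ∣ q ∣ < ∣ p ∣ → Nonempty (p ─ q)
∣q∣<∣p∣⇒Nonempty[p─q] p q ∣q∣<∣p∣ with nonempty? (p ─ q)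
... | yes p─q≠∅ = p─q≠∅
... | no p─q=∅ = contradiction (p⊆q⇒∣p∣≤∣q∣ p⊆q) (<⇒≱ ∣q∣<∣p∣)
  where
  p⊆q : p ⊆ q
  p⊆q {x} x∈p with x ∈? q
  ... | yes x∈q = x∈q
  ... | no x∉q = contradiction (x , x∈p∧x∉q⇒x∈p─q x∈p x∉q) p─q=∅

3≤∣p∣ : {p : Subset n} {x y z : Fin n} → x ∈ p → y ∈ p → z ∈ p →
        x ≢ y → x ≢ z → y ≢ z → 3 ≤ ∣ p ∣
3≤∣p∣ x∈p y∈p z∈p x≢y x≢z y≢z =
  ≤-trans (s≤s (≤-trans (s≤s (≤-trans (s≤s z≤n) ∣p-x-y-z∣<∣p-x-y∣)) ∣p-x-y∣<∣p-x∣)) ∣p-x∣<∣p∣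
  where
  ∣p-x∣<∣p∣ = x∈p⇒∣p-x∣<∣p∣ x∈p
  ∣p-x-y∣<∣p-x∣ = x∈p⇒∣p-x∣<∣p∣ (x∈p∧x≢y⇒x∈p-y y∈p (x≢y ∘ sym))
  ∣p-x-y-z∣<∣p-x-y∣ =
    x∈p⇒∣p-x∣<∣p∣ (x∈p∧x≢y⇒x∈p-y (x∈p∧x≢y⇒x∈p-y z∈p (x≢z ∘ sym)) (y≢z ∘ sym))

nodesFrom : ℕ → Subset n
nodesFrom k = tabulate λ v → k ≤ᵇ toℕ v

node : ℕ → Subset n
node k = tabulate λ v → toℕ v ≡ᵇ k

∈-nodesFrom : {k : ℕ} {v : Fin n} → v ∈ nodesFrom k ⇔ k ≤ toℕ v
∈-nodesFrom = mk⇔ (≤ᵇ⇒≤ _ _ ∘ to ∈-tabulate) (from ∈-tabulate ∘ ≤⇒≤ᵇ)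

∈-node : {k : ℕ} {v : Fin n} → v ∈ node k ⇔ toℕ v ≡ k
∈-node = mk⇔ (≡ᵇ⇒≡ _ _ ∘ to ∈-tabulate) (from ∈-tabulate ∘ ≡⇒≡ᵇ _ _)

∣node∣≤1 : (k : ℕ) → ∣ node {n} k ∣ ≤ 1
∣node∣≤1 {n} k with nonempty? (node {n} k)
... | yes (v , v∈) = ≤-trans (p⊆q⇒∣p∣≤∣q∣ node⊆⁅v⁆) (≤-reflexive (∣⁅x⁆∣≡1 v))
  where
  node⊆⁅v⁆ : node {n} k ⊆ ⁅ v ⁆
  node⊆⁅v⁆ u∈ =
    subst (_∈ ⁅ v ⁆) (toℕ-injective (trans (to ∈-node v∈) (sym (to ∈-node u∈)))) (x∈⁅x⁆ v)
... | no empty = subst (_≤ 1) (sym (trans (cong ∣_∣ (Empty-unique empty)) (∣⊥∣≡0 n))) z≤n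

window : ℕ → ℕ → Subset n
window k zero    = ⊥
window k (suc w) = node k ∪ window (suc k) w

∣window∣≤ : (k w : ℕ) → ∣ window {n} k w ∣ ≤ w
∣window∣≤ {n} k zero    = ≤-reflexive (∣⊥∣≡0 n)
∣window∣≤ {n} k (suc w) =
  ≤-trans (∣p∪q∣≤∣p∣+∣q∣ (node {n} k) (window (suc k) w))
          (+-mono-≤ (∣node∣≤1 {n} k) (∣window∣≤ (suc k) w))

∉window : {k w : ℕ} {v : Fin n} → k ≤ toℕ v → v ∉ window k w → k + w ≤ toℕ v
∉window {k = k} {zero}  k≤v _   = subst (_≤ _) (sym (+-identityʳ k)) k≤v
∉window {k = k} {suc w} {v} k≤v v∉ =
  subst (_≤ toℕ v) (sym (+-suc k w)) (∉window k<v (v∉ ∘ x∈p∪q⁺ ∘ inj₂))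
  where
  k<v : k < toℕ v
  k<v = ≤∧≢⇒< k≤v λ k≡v → v∉ (x∈p∪q⁺ (inj₁ (from ∈-node (sym k≡v))))

-- Defined with _<ᵇ_ rather than _<?_ so that ∣below∣ computes in the suc case.
below : ℕ → Subset n
below a = tabulate λ v → toℕ v <ᵇ a

∈-below : {a : ℕ} {v : Fin n} → v ∈ below a ⇔ toℕ v < a
∈-below = mk⇔ (<ᵇ⇒< _ _ ∘ to ∈-tabulate) (from ∈-tabulate ∘ <⇒<ᵇ)

∣below∣ : (a b : ℕ) → ∣ below {a + b} a ∣ ≡ a
∣below∣ zero    b =
  trans (cong ∣_∣ (Empty-unique {p = below {b} 0} λ (_ , v∈) → n≮0 (to ∈-below v∈))) (∣⊥∣≡0 b)
∣below∣ (suc a) b = cong suc (∣below∣ a b)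

toℕ-≢ : {u v : Fin n} → toℕ u ≢ toℕ v → u ≢ v
toℕ-≢ ne = ne ∘ cong toℕ

T-anyFin⁻ : (f : Fin n → Bool) → T (anyFin f) → ∃ λ u → T (f u)
T-anyFin⁻ {suc n} f t with to T-∨ t
... | inj₁ t₀ = zero , t₀
... | inj₂ t₊ with T-anyFin⁻ (f ∘ suc) t₊
...   | u , tu = suc u , tu

T-anyFin⁺ : (f : Fin n → Bool) {u : Fin n} → T (f u) → T (anyFin f)
T-anyFin⁺ f {zero}  t = from T-∨ (inj₁ t)
T-anyFin⁺ f {suc u} t = from T-∨ (inj₂ (T-anyFin⁺ (f ∘ suc) t))

module _ (G : Graph n) where

  ∈-N⁻ : {W : Subset n} {v : Fin n} → v ∈ N G W → ∃ λ u → u ∈ W × T (adj G u v)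
  ∈-N⁻ {W} {v} v∈N with T-anyFin⁻ _ (proj₂ (to T-∧ (to ∈-tabulate v∈N)))
  ... | u , t with to T-∧ t
  ...   | u∈W , u~v = u , from ∈⇔T-lookup u∈W , u~v

  ∈-N⁺ : {W : Subset n} {u v : Fin n} → v ∉ W → u ∈ W → T (adj G u v) → v ∈ N G W
  ∈-N⁺ {W} {v = v} v∉W u∈W u~v = from ∈-tabulate (from T-∧
    ( from T-not⇔¬T (v∉W ∘ from ∈⇔T-lookup)
    , T-anyFin⁺ (λ u → lookup W u ∧ adj G u v) (from T-∧ (to ∈⇔T-lookup u∈W , u~v))))

  adj-sym : {u v : Fin n} → T (adj G u v) → T (adj G v u)
  adj-sym {u} {v} = subst T (Graph.sym G u v)

  adj-irrefl : {u v : Fin n} → T (adj G u v) → u ≢ v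
  adj-irrefl {u} u~u refl = subst T (irrefl G u) u~u

  -- closure ⁅ x ⁆ is the closed neighbourhood N[x], and step G B F is
  -- definitionally closure (B ─ F).
  closure : Subset n → Subset n
  closure W = W ∪ N G W

  ∈-closure⁻ : {W : Subset n} {v : Fin n} → v ∈ closure W →
               v ∈ W ⊎ ∃ λ u → u ∈ W × T (adj G u v)
  ∈-closure⁻ {W} v∈ with x∈p∪q⁻ W (N G W) v∈
  ... | inj₁ v∈W = inj₁ v∈W
  ... | inj₂ v∈N = inj₂ (∈-N⁻ v∈N)

  ∈-closure⁺ : {W : Subset n} {u v : Fin n} → u ∈ W → T (adj G u v) → v ∈ closure W
  ∈-closure⁺ {W} {v = v} u∈W u~v with v ∈? W
  ... | yes v∈W = x∈p∪q⁺ (inj₁ v∈W)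
  ... | no v∉W = x∈p∪q⁺ (inj₂ (∈-N⁺ v∉W u∈W u~v))

  W⊆closure : {W : Subset n} → W ⊆ closure W
  W⊆closure = p⊆p∪q _

  closure-mono : {W W′ : Subset n} → W ⊆ W′ → closure W ⊆ closure W′
  closure-mono W⊆W′ v∈ with ∈-closure⁻ v∈
  ... | inj₁ v∈W = W⊆closure (W⊆W′ v∈W)
  ... | inj₂ (u , u∈W , u~v) = ∈-closure⁺ (W⊆W′ u∈W) u~v

  ∣q∣<∣closure⁅x⁆∣ : {x : Fin n} {q : Subset n} → x ∉ q → (∀ {v} → v ∈ q → T (adj G x v)) →
                     ∣ q ∣ < ∣ closure ⁅ x ⁆ ∣
  ∣q∣<∣closure⁅x⁆∣ {x} x∉q q⊆nbrs =
    p⊂q⇒∣p∣<∣q∣ ((∈-closure⁺ (x∈⁅x⁆ x) ∘ q⊆nbrs) , x , W⊆closure (x∈⁅x⁆ x) , x∉q)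

  step-monoˡ : {B B′ F : Subset n} → B ⊆ B′ → step G B F ⊆ step G B′ F
  step-monoˡ {B} {F = F} B⊆B′ = closure-mono λ x∈ →
    x∈p∧x∉q⇒x∈p─q (B⊆B′ (p─q⊆p B F x∈)) (x∈p─q⇒x∉q x∈)

  step-≡⊥ : {B F : Subset n} → B ⊆ F → step G B F ≡ ⊥
  step-≡⊥ {B} {F} B⊆F = Empty-unique empty
    where
    burnt : {x : Fin n} → x ∉ B ─ F
    burnt x∈ = x∈p─q⇒x∉q x∈ (B⊆F (p─q⊆p B F x∈))
    empty : Empty (step G B F)
    empty (v , v∈) with ∈-closure⁻ v∈
    ... | inj₁ v∈B─F = burnt v∈B─F
    ... | inj₂ (_ , u∈B─F , _) = burnt u∈B─F

  closure⁅x⁆⊆step : {B F : Subset n} {x : Fin n} → x ∈ B ─ F → closure ⁅ x ⁆ ⊆ step G B F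
  closure⁅x⁆⊆step x∈B─F = closure-mono λ y∈⁅x⁆ →
    subst (_∈ _) (sym (x∈⁅y⁆⇒x≡y _ y∈⁅x⁆)) x∈B─F

  -- Lower bound

  module _ (closedNbhd-large : ∀ x → m < ∣ closure ⁅ x ⁆ ∣) where

    step-large : {B F : Subset n} → ∣ F ∣ ≤ m → m < ∣ B ∣ → m < ∣ step G B F ∣
    step-large {B} {F} ∣F∣≤m m<∣B∣ with ∣q∣<∣p∣⇒Nonempty[p─q] B F (≤-<-trans ∣F∣≤m m<∣B∣)
    ... | x , x∈B─F = <-≤-trans (closedNbhd-large x) (p⊆q⇒∣p∣≤∣q∣ (closure⁅x⁆⊆step x∈B─F))

    burnFrom-large : (B : Subset n) (Fs : List (Subset n)) → IsStrategy m Fs →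
                     m < ∣ B ∣ → m < ∣ burnFrom G B Fs ∣
    burnFrom-large B []       All.[]           m<∣B∣ = m<∣B∣
    burnFrom-large B (F ∷ Fs) (∣F∣≤m All.∷ st) m<∣B∣ =
      burnFrom-large (step G B F) Fs st (step-large {B} {F} ∣F∣≤m m<∣B∣)

    ¬HasWinning : Fin n → ¬ HasWinning G m
    ¬HasWinning x₀ (Fs , st , win) = n≮0 (subst (m <_) (∣⊥∣≡0 n) m<∣⊥∣)
      where
      m<∣⊤∣ : m < ∣ ⊤ {n} ∣
      m<∣⊤∣ = subst (m <_) (sym (∣⊤∣≡n n))
                (<-≤-trans (closedNbhd-large x₀) (∣p∣≤n (closure ⁅ x₀ ⁆)))
      m<∣⊥∣ : m < ∣ ⊥ {n} ∣
      m<∣⊥∣ = subst (λ B → m < ∣ B ∣) win (burnFrom-large ⊤ Fs st m<∣⊤∣)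

  -- Upper bound

  HasWinning-mono : {m m′ : ℕ} → m ≤ m′ → HasWinning G m → HasWinning G m′
  HasWinning-mono m≤m′ (Fs , st , win) = Fs , All.map (λ ∣F∣≤m → ≤-trans ∣F∣≤m m≤m′) st , win

  burnFrom-sweep : (r : ℕ) (F I : ℕ → Subset n) {B : Subset n} →
                   (∀ k → step G (I k) (F k) ⊆ I (suc k)) → I r ⊆ F r → B ⊆ I 0 →
                   burnFrom G B (applyUpTo F (suc r)) ≡ ⊥
  burnFrom-sweep zero    F I inv Iᵣ⊆Fᵣ B⊆I₀ = step-≡⊥ (⊆-trans B⊆I₀ Iᵣ⊆Fᵣ)
  burnFrom-sweep (suc r) F I inv Iᵣ⊆Fᵣ B⊆I₀ =
    burnFrom-sweep r (F ∘ suc) (I ∘ suc) (inv ∘ suc) Iᵣ⊆Fᵣ (⊆-trans (step-monoˡ B⊆I₀) (inv 0))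

  HasBandwidthOutside : Subset n → ℕ → Set
  HasBandwidthOutside S w = ∀ {u v} → T (adj G u v) → u ∉ S → v ∉ S → toℕ u ≤ toℕ v + w

  -- Round k protects S and the nodes k, …, k + w; before it, only S and nodes ≥ k burn.
  bandwidth⇒HasWinning : {S : Subset n} {w : ℕ} → HasBandwidthOutside S w →
                         HasWinning G (∣ S ∣ + suc w)
  bandwidth⇒HasWinning {S} {w} bandwidth =
    applyUpTo F (suc n) , applyUpTo⁺₂ F (suc n) ∣F∣≤ , burnFrom-sweep n F I invariant Iₙ⊆Fₙ ⊤⊆I₀
    where
    F I : ℕ → Subset n
    F k = S ∪ window k (suc w)
    I k = S ∪ nodesFrom k

    ∣F∣≤ : ∀ k → ∣ F k ∣ ≤ ∣ S ∣ + suc w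
    ∣F∣≤ k = ≤-trans (∣p∪q∣≤∣p∣+∣q∣ S (window k (suc w)))
                     (+-monoʳ-≤ ∣ S ∣ (∣window∣≤ {n} k (suc w)))

    Iₙ⊆Fₙ : I n ⊆ F n
    Iₙ⊆Fₙ v∈ with x∈p∪q⁻ S (nodesFrom n) v∈
    ... | inj₁ v∈S = x∈p∪q⁺ (inj₁ v∈S)
    ... | inj₂ v∈N = contradiction (to ∈-nodesFrom v∈N) (<⇒≱ (toℕ<n _))

    ⊤⊆I₀ : ⊤ ⊆ I 0
    ⊤⊆I₀ _ = x∈p∪q⁺ (inj₂ (from ∈-nodesFrom z≤n))

    survivor : ∀ {k u} → u ∈ I k ─ F k → u ∉ S × suc k + w ≤ toℕ u
    survivor {k} {u} u∈ with x∈p∪q⁻ S (nodesFrom k) (p─q⊆p (I k) (F k) u∈)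
    ... | inj₁ u∈S = contradiction (x∈p∪q⁺ (inj₁ u∈S)) (x∈p─q⇒x∉q u∈)
    ... | inj₂ u∈N = u∉S , subst (_≤ toℕ u) (+-suc k w)
                             (∉window {n} {k} (to (∈-nodesFrom {k = k}) u∈N) (u∉F ∘ x∈p∪q⁺ ∘ inj₂))
      where
      u∉F = x∈p─q⇒x∉q u∈
      u∉S = u∉F ∘ x∈p∪q⁺ ∘ inj₁

    invariant : ∀ k → step G (I k) (F k) ⊆ I (suc k)
    invariant k {v} v∈ with ∈-closure⁻ v∈
    ... | inj₁ v∈I─F =
      x∈p∪q⁺ (inj₂ (from ∈-nodesFrom (≤-trans (m≤m+n (suc k) w) (proj₂ (survivor v∈I─F)))))
    ... | inj₂ (u , u∈I─F , u~v) with v ∈? S | survivor u∈I─F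
    ...   | yes v∈S | _ = x∈p∪q⁺ (inj₁ v∈S)
    ...   | no v∉S | u∉S , 1+k+w≤u = x∈p∪q⁺ (inj₂ (from ∈-nodesFrom
            (+-cancelʳ-≤ w (suc k) (toℕ v) (≤-trans 1+k+w≤u (bandwidth u~v u∉S v∉S)))))

  IsVertexCover : Subset n → Set
  IsVertexCover S = ∀ {u v} → T (adj G u v) → u ∈ S ⊎ v ∈ S

  vertexCover⇒HasWinning : {S : Subset n} → IsVertexCover S → HasWinning G (∣ S ∣ + 1)
  vertexCover⇒HasWinning cover = bandwidth⇒HasWinning λ u~v u∉S v∉S → case cover u~v of λ where
    (inj₁ u∈S) → contradiction u∈S u∉S
    (inj₂ v∈S) → contradiction v∈S v∉S

  FfnIs-intro : {k : ℕ} → Fin n → 1 ≤ k → HasWinning G k →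
                (∀ x → k ≤ ∣ closure ⁅ x ⁆ ∣) → FfnIs G k
  FfnIs-intro {k} x₀ 1≤k win closedNbhd≥k = 1≤k , win , λ m _ → minimal m
    where
    minimal : ∀ m → HasWinning G m → k ≤ m
    minimal m win-m with k ≤? m
    ... | yes k≤m = k≤m
    ... | no k≰m = contradiction win-m (¬HasWinning (λ x → <-≤-trans (≰⇒> k≰m) (closedNbhd≥k x)) x₀)

module _ (r : Fin n → Fin n → Bool) where

  adj-mkGraph⁻ : {u v : Fin n} → T (adj (mkGraph r) u v) → T (r u v) ⊎ T (r v u)
  adj-mkGraph⁻ = to T-∨ ∘ proj₁ ∘ to T-∧

  adj-mkGraph⁺ : {u v : Fin n} → T (r u v) ⊎ T (r v u) → u ≢ v → T (adj (mkGraph r) u v)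
  adj-mkGraph⁺ r-uv u≢v = from T-∧ (from T-∨ r-uv , from T-not⇔¬T (u≢v ∘ toWitness))

-- Complete graphs

complete-⊤⊆closure⁅x⁆ : (x : Fin n) → ⊤ ⊆ closure (complete n) ⁅ x ⁆
complete-⊤⊆closure⁅x⁆ {n} x {v} _ with v ≟ᶠ x
... | yes refl = W⊆closure (complete n) (x∈⁅x⁆ x)
... | no v≢x = ∈-closure⁺ (complete n) (x∈⁅x⁆ x) (adj-mkGraph⁺ (λ _ _ → true) (inj₁ _) (v≢x ∘ sym))

complete-vertexCover : (x : Fin n) → IsVertexCover (complete n) (⊤ - x)
complete-vertexCover {n} x {u} {v} u~v with u ≟ᶠ x
... | no u≢x = inj₁ (x∈p∧x≢y⇒x∈p-y ∈⊤ u≢x)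
... | yes refl = inj₂ (x∈p∧x≢y⇒x∈p-y ∈⊤ (adj-irrefl (complete n) u~v ∘ sym))

complete-closedNbhd≥ : (x : Fin n) → n ≤ ∣ closure (complete n) ⁅ x ⁆ ∣
complete-closedNbhd≥ {n} x =
  subst (_≤ ∣ closure (complete n) ⁅ x ⁆ ∣) (∣⊤∣≡n n) (p⊆q⇒∣p∣≤∣q∣ (complete-⊤⊆closure⁅x⁆ x))

complete-winning : (x : Fin n) → HasWinning (complete n) n
complete-winning {n} x = HasWinning-mono (complete n) ∣⊤-x∣+1≤n
  (vertexCover⇒HasWinning (complete n) (complete-vertexCover x))
  where
  ∣⊤-x∣+1≤n : ∣ ⊤ - x ∣ + 1 ≤ n
  ∣⊤-x∣+1≤n = subst₂ _≤_ (+-comm 1 ∣ ⊤ - x ∣) (∣⊤∣≡n n) (x∈p⇒∣p-x∣<∣p∣ {n} {x} {⊤} ∈⊤)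

ffn-complete : ∀ n → FfnIs (complete (suc n)) (suc n)
ffn-complete n =
  FfnIs-intro (complete (suc n)) zero (s≤s z≤n) (complete-winning zero) complete-closedNbhd≥

-- Complete bipartite graphs

module _ (a b : ℕ) where

  private
    G : Graph (a + b)
    G = completeBipartite a b

    L : Subset (a + b)
    L = below a

    left? : Fin (a + b) → Bool
    left? u = ⌊ toℕ u <? a ⌋

    crosses? : Fin (a + b) → Fin (a + b) → Bool
    crosses? u v = left? u ∧ not (left? v)

    T-left? : {u : Fin (a + b)} → T (left? u) ⇔ u ∈ L
    T-left? = mk⇔ (from ∈-below ∘ toWitness) (fromWitness ∘ to (∈-below {a = a}))

    T-crosses? : {u v : Fin (a + b)} → T (crosses? u v) ⇔ (u ∈ L × v ∉ L)
    T-crosses? = mk⇔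
      (λ t → to T-left? (proj₁ (to T-∧ t)) , to T-not⇔¬T (proj₂ (to T-∧ t)) ∘ from T-left?)
      (λ (u∈L , v∉L) → from T-∧ (from T-left? u∈L , from T-not⇔¬T (v∉L ∘ to T-left?)))

  bipartite-adj⁺ : {u v : Fin (a + b)} → u ∈ L → v ∉ L → T (adj G u v)
  bipartite-adj⁺ u∈L v∉L =
    adj-mkGraph⁺ crosses? (inj₁ (from T-crosses? (u∈L , v∉L))) λ { refl → v∉L u∈L }

  bipartite-adj⁻ : {u v : Fin (a + b)} → T (adj G u v) → (u ∈ L × v ∉ L) ⊎ (v ∈ L × u ∉ L)
  bipartite-adj⁻ u~v with adj-mkGraph⁻ crosses? u~v
  ... | inj₁ t = inj₁ (to T-crosses? t)
  ... | inj₂ t = inj₂ (to T-crosses? t)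

  bipartite-vertexCoverˡ : IsVertexCover G L
  bipartite-vertexCoverˡ u~v with bipartite-adj⁻ u~v
  ... | inj₁ (u∈L , _) = inj₁ u∈L
  ... | inj₂ (v∈L , _) = inj₂ v∈L

  bipartite-vertexCoverʳ : IsVertexCover G (∁ L)
  bipartite-vertexCoverʳ u~v with bipartite-adj⁻ u~v
  ... | inj₁ (_ , v∉L) = inj₂ (x∉p⇒x∈∁p v∉L)
  ... | inj₂ (_ , u∉L) = inj₁ (x∉p⇒x∈∁p u∉L)

  ∣∁below∣ : ∣ ∁ L ∣ ≡ b
  ∣∁below∣ = trans (∣∁p∣≡n∸∣p∣ L) (trans (cong (a + b ∸_) (∣below∣ a b)) (m+n∸m≡n a b))

  private
    ⊓+1≤ : ∀ {c} → a ⊓ b ≤ c → a ⊓ b + 1 ≤ suc c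
    ⊓+1≤ {c} ≤c = subst (_≤ suc c) (+-comm 1 (a ⊓ b)) (s≤s ≤c)

  bipartite-closedNbhd≥ : ∀ x → a ⊓ b + 1 ≤ ∣ closure G ⁅ x ⁆ ∣
  bipartite-closedNbhd≥ x with x ∈? L
  ... | yes x∈L = ≤-trans (⊓+1≤ (m⊓n≤n a b)) (subst (λ k → k < ∣ closure G ⁅ x ⁆ ∣) ∣∁below∣
          (∣q∣<∣closure⁅x⁆∣ G (x∈p⇒x∉∁p x∈L) (bipartite-adj⁺ x∈L ∘ x∈∁p⇒x∉p)))
  ... | no x∉L = ≤-trans (⊓+1≤ (m⊓n≤m a b)) (subst (λ k → k < ∣ closure G ⁅ x ⁆ ∣) (∣below∣ a b)
          (∣q∣<∣closure⁅x⁆∣ G x∉L λ v∈L → adj-sym G (bipartite-adj⁺ v∈L x∉L)))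

  bipartite-winning : HasWinning G (a ⊓ b + 1)
  bipartite-winning with ⊓-sel a b
  ... | inj₁ a⊓b≡a = subst (λ k → HasWinning G (k + 1)) (trans (∣below∣ a b) (sym a⊓b≡a))
                       (vertexCover⇒HasWinning G bipartite-vertexCoverˡ)
  ... | inj₂ a⊓b≡b = subst (λ k → HasWinning G (k + 1)) (trans ∣∁below∣ (sym a⊓b≡b))
                       (vertexCover⇒HasWinning G bipartite-vertexCoverʳ)

ffn-completeBipartite : ∀ n m → FfnIs (completeBipartite (suc n) (suc m)) ((suc n ⊓ suc m) + 1)
ffn-completeBipartite n m =
  FfnIs-intro (completeBipartite (suc n) (suc m)) zero (m≤n+m 1 (suc n ⊓ suc m))
    (bipartite-winning (suc n) (suc m)) (bipartite-closedNbhd≥ (suc n) (suc m))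

-- Cycles

module _ (n : ℕ) where

  private
    C : Graph (3 + n)
    C = cycle (3 + n)

    succ? : Fin (3 + n) → Fin (3 + n) → Bool
    succ? u v = ⌊ suc (toℕ u) ≟ toℕ v ⌋ ∨ (⌊ suc (toℕ u) ≟ 3 + n ⌋ ∧ ⌊ toℕ v ≟ 0 ⌋)

    last : Fin (3 + n)
    last = fromℕ (2 + n)

  IsSucc : Fin (3 + n) → Fin (3 + n) → Set
  IsSucc u v = toℕ v ≡ suc (toℕ u) ⊎ (suc (toℕ u) ≡ 3 + n × toℕ v ≡ 0)

  T-succ? : {u v : Fin (3 + n)} → T (succ? u v) ⇔ IsSucc u v
  T-succ? {u} {v} with suc (toℕ u) ≟ toℕ v | suc (toℕ u) ≟ 3 + n | toℕ v ≟ 0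
  ... | yes next | _          | _          = mk⇔ (λ _ → inj₁ (sym next)) _
  ... | no _     | yes u-last | yes v-zero = mk⇔ (λ _ → inj₂ (u-last , v-zero)) _
  ... | no ¬next | yes _      | no ¬v-zero = mk⇔ (λ ()) [ ¬next ∘ sym , ¬v-zero ∘ proj₂ ]
  ... | no ¬next | no ¬u-last | _          = mk⇔ (λ ()) [ ¬next ∘ sym , ¬u-last ∘ proj₁ ]

  IsSucc-irrefl : {u : Fin (3 + n)} → ¬ IsSucc u u
  IsSucc-irrefl (inj₁ u≡1+u) = 1+n≢n (sym u≡1+u)
  IsSucc-irrefl (inj₂ (1+u≡3+n , u≡0)) with trans (cong suc (sym u≡0)) 1+u≡3+n
  ... | ()

  cycle-adj⁺ : {u v : Fin (3 + n)} → IsSucc u v → T (adj C u v)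
  cycle-adj⁺ {u} {v} u→v =
    adj-mkGraph⁺ succ? {u} {v} (inj₁ (from (T-succ? {u} {v}) u→v)) λ { refl → IsSucc-irrefl u→v }

  cycle-adj⁻ : {u v : Fin (3 + n)} → T (adj C u v) → IsSucc u v ⊎ IsSucc v u
  cycle-adj⁻ {u} {v} u~v with adj-mkGraph⁻ succ? {u} {v} u~v
  ... | inj₁ t = inj₁ (to (T-succ? {u} {v}) t)
  ... | inj₂ t = inj₂ (to (T-succ? {v} {u}) t)

  private
    cycle-adj-inject₁ : (y : Fin (2 + n)) → T (adj C (suc y) (inject₁ y))
    cycle-adj-inject₁ y = adj-sym C {inject₁ y} {suc y}
      (cycle-adj⁺ {inject₁ y} {suc y} (inj₁ (cong suc (sym (toℕ-inject₁ y)))))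

  cycle-neighbours : (x : Fin (3 + n)) →
    ∃ λ y → ∃ λ z → T (adj C x y) × T (adj C x z) × y ≢ z
  cycle-neighbours zero = suc zero , last ,
    cycle-adj⁺ {zero} {suc zero} (inj₁ refl) ,
    adj-sym C {last} {zero}
      (cycle-adj⁺ {last} {zero} (inj₂ (cong suc (toℕ-fromℕ (2 + n)) , refl))) ,
    λ ()
  cycle-neighbours (suc y) with suc (suc (toℕ y)) <? 3 + n
  ... | yes lt = inject₁ y , fromℕ< lt , cycle-adj-inject₁ y ,
    cycle-adj⁺ {suc y} {fromℕ< lt} (inj₁ (toℕ-fromℕ< lt)) ,
    toℕ-≢ (subst₂ _≢_ (sym (toℕ-inject₁ y)) (sym (toℕ-fromℕ< lt)) (<⇒≢ (s≤s (n≤1+n (toℕ y)))))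
  ... | no ¬lt = inject₁ y , zero , cycle-adj-inject₁ y ,
    cycle-adj⁺ {suc y} {zero} (inj₂ (y-last , refl)) ,
    toℕ-≢ inject₁y≢0
    where
    y-last : suc (suc (toℕ y)) ≡ 3 + n
    y-last = ≤-antisym (toℕ<n (suc y)) (≮⇒≥ ¬lt)
    inject₁y≢0 : toℕ (inject₁ y) ≢ 0
    inject₁y≢0 e with trans (cong (λ i → suc (suc i)) (trans (sym e) (toℕ-inject₁ y))) y-last
    ... | ()

  cycle-closedNbhd≥ : ∀ x → 3 ≤ ∣ closure C ⁅ x ⁆ ∣
  cycle-closedNbhd≥ x with cycle-neighbours x
  ... | y , z , x~y , x~z , y≢z =
    3≤∣p∣ (W⊆closure C (x∈⁅x⁆ x)) (∈-closure⁺ C (x∈⁅x⁆ x) x~y) (∈-closure⁺ C (x∈⁅x⁆ x) x~z)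
          (adj-irrefl C x~y) (adj-irrefl C x~z) y≢z

  private
    1+u≡3+n⇒u∈⁅last⁆ : {u : Fin (3 + n)} → suc (toℕ u) ≡ 3 + n → u ∈ ⁅ last ⁆
    1+u≡3+n⇒u∈⁅last⁆ 1+u≡3+n = subst (_∈ ⁅ last ⁆)
      (toℕ-injective (trans (toℕ-fromℕ (2 + n)) (sym (suc-injective 1+u≡3+n)))) (x∈⁅x⁆ last)

  -- Removing the last node leaves the path 0 − 1 − ⋯ − (n + 1).
  cycle-bandwidth : HasBandwidthOutside C ⁅ last ⁆ 1
  cycle-bandwidth {u} {v} u~v u∉S v∉S with cycle-adj⁻ {u} {v} u~v
  ... | inj₁ (inj₁ v≡1+u)         =
    ≤-trans (n≤1+n (toℕ u)) (≤-trans (≤-reflexive (sym v≡1+u)) (m≤m+n (toℕ v) 1))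
  ... | inj₁ (inj₂ (1+u≡3+n , _)) = contradiction (1+u≡3+n⇒u∈⁅last⁆ 1+u≡3+n) u∉S
  ... | inj₂ (inj₁ u≡1+v)         = ≤-reflexive (trans u≡1+v (+-comm 1 (toℕ v)))
  ... | inj₂ (inj₂ (1+v≡3+n , _)) = contradiction (1+u≡3+n⇒u∈⁅last⁆ 1+v≡3+n) v∉S

  cycle-winning : HasWinning C 3
  cycle-winning =
    subst (λ k → HasWinning C (k + 2)) (∣⁅x⁆∣≡1 last) (bandwidth⇒HasWinning C cycle-bandwidth)

ffn-cycle : ∀ n → FfnIs (cycle (3 + n)) 3
ffn-cycle n = FfnIs-intro (cycle (3 + n)) zero (s≤s z≤n) (cycle-winning n) (cycle-closedNbhd≥ n)

proposition2 : (∀ n → FfnIs (complete (suc n)) (suc n))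
    × (∀ n m → FfnIs (completeBipartite (suc n) (suc m)) ((suc n ⊓ suc m) + 1))
    × (∀ n → FfnIs (cycle (3 + n)) 3)
proposition2 = ffn-complete , ffn-completeBipartite , ffn-cycle
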